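{- Let $p$ be an odd prime, $n$ an odd integer, $F=\mathbb{F}_{p^n}$, and let $i$ be an integer with $0<i<n$ and $\gcd(i,n)=1$. Then the map $\varphi\colon F^\times\to F$, $\varphi(a)=a^{p^i-1}-a^{p^{n-i}-1}$, is $(p-1)$-to-$1$, i.e. every element of the image of $\varphi$ has exactly $p-1$ preimages. -}

module Defs where

open import Level using (_⊔_)
open import Data.Nat as ℕ using (ℕ)
open import Data.Fin using (Fin)
open import Data.Product using (∃)
open import Data.Vec using (count; tabulate)
open import Algebra.Bundles using (CommutativeRing; Semiring)
open import Relation.Nullary using (¬_)
open import Relation.Nullary.Decidable using (¬?; _×-dec_)
open import Relation.Binary using (Decidable)
import Relation.Binary.PropositionalEquality as ≡
open import Function.Bundles using (Bijection)
import Algebra.Definitions.RawSemiring as RS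

module _ {c ℓ} (R : CommutativeRing c ℓ) where
  open CommutativeRing R

  infixr 8 _^ᴿ_
  _^ᴿ_ : Carrier → ℕ → Carrier
  _^ᴿ_ = RS._^_ (Semiring.rawSemiring semiring)

  record IsField : Set (c ⊔ ℓ) where
    field
      0≉1     : ¬ (0# ≈ 1#)
      inverse : ∀ x → ¬ (x ≈ 0#) → ∃ λ y → x * y ≈ 1#

  HasOrder : ℕ → Set (c ⊔ ℓ)
  HasOrder q = Bijection (≡.setoid (Fin q)) setoid

  preimageCount : (_≟_ : Decidable _≈_) (q : ℕ) → HasOrder q →
                  (Carrier → Carrier) → Carrier → ℕ
  preimageCount _≟_ q e φ b =
    count (λ x → ¬? (x ≟ 0#) ×-dec (φ x ≟ b)) (tabulate (Bijection.to e))

  φ : ℕ → ℕ → ℕ → Carrier → Carrier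
  φ p n i a = a ^ᴿ (p ℕ.^ i ℕ.∸ 1) - a ^ᴿ (p ℕ.^ (n ℕ.∸ i) ℕ.∸ 1)

module Submission where

-- Write σ x = x ^ (p ^ i) and τ x = x ^ (p ^ (n - i)); these are ring automorphisms of F with
-- σ ∘ τ = id, and a · φ(a) = σ a - τ a.  If φ(b) = φ(a) for nonzero a, b, put t = b / a and
-- u = t - σ t.  Applying σ to a · φ(a) = σ a - τ a at a and at t a gives σ u · σ² a + u · a = 0.
-- For u ≠ 0 the norm N x = x · σ x ⋯ σⁿ⁻¹ x turns this into N u · N a = N(-1) · N u · N a, and
-- N(-1) = -1 as n is odd, which is impossible as p is odd.  So σ t = t, hence t ^ p = t since
-- gcd(i, n) = 1, i.e. t lies in 𝔽ₚ.  Conversely φ(c a) = φ(a) for c ∈ 𝔽ₚˣ, as c ^ (p ^ k - 1) = 1.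
-- Thus the fibre of φ(a) in Fˣ is 𝔽ₚˣ · a, which has p - 1 elements.

open import Defs
open import Data.Nat as ℕ using (ℕ; zero; suc; z≤n; s≤s; _<_; _∸_; _%_; _/_; NonZero; NonTrivial)
open import Data.Nat.DivMod using (m≡m%n+[m/n]*n)
open import Data.Nat.GeneralisedArithmetic using (iterate)
import Data.Nat.Properties as ℕₚ
open import Data.Nat.Combinatorics using (_C_; nC1≡n; nCn≡1; nCk+nC[k+1]≡[n+1]C[k+1]; k>n⇒nCk≡0)
open import Data.Nat.Divisibility using (_∣_; divides; ∣⇒≤)
open import Data.Nat.Primality using (Prime; euclidsLemma; prime⇒nonTrivial)
open import Data.Nat.Coprimality using (Coprime; coprime-Bézout; prime⇒coprime; gcd≡1⇒coprime)
open import Data.Nat.GCD using (gcd; module Bézout)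
open import Data.Fin as Fin using (Fin; toℕ) renaming (zero to fz; suc to fs)
import Data.Fin.Properties as Fin
open import Data.Vec as Vec using (Vec; []; _∷_; count; tabulate)
import Data.Product as Product
open Product using (∃; _,_; proj₁; proj₂)
open import Data.Sum using (inj₁; inj₂)
open import Data.Empty using (⊥; ⊥-elim)
open import Function.Definitions using (Injective; Congruent)
open import Function.Bundles using (Bijection)
open import Data.Fin.Permutation using (Permutation; permutation; _⟨$⟩ʳ_)
open import Data.Vec.Functional using (removeAt)
open import Algebra.Bundles using (CommutativeRing)
import Algebra.Properties.Semiring.Binomial
open import Relation.Nullary using (¬_; Dec; yes; no)
open import Relation.Nullary.Decidable using (¬?; _×-dec_)
open import Relation.Unary using (Pred)
open import Relation.Binary using (Decidable; tri<; tri≈; tri>)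
import Relation.Binary.PropositionalEquality as ≡
open ≡ using (_≡_; _≢_)
import Algebra.Properties.CommutativeMonoid.Sum ℕₚ.+-0-commutativeMonoid as ℕΣ

module _ where

  open ≡ using (refl; sym; trans; cong; cong₂; subst; module ≡-Reasoning)
  open import Data.Nat using (_+_; _*_)

  [1+k]*[1+n]C[1+k]≡[1+n]*nCk : ∀ n k → suc k * (suc n C suc k) ≡ suc n * (n C k)
  [1+k]*[1+n]C[1+k]≡[1+n]*nCk zero zero = refl
  [1+k]*[1+n]C[1+k]≡[1+n]*nCk zero (suc k)
    rewrite k>n⇒nCk≡0 {1} {suc (suc k)} (s≤s (s≤s z≤n)) | k>n⇒nCk≡0 {0} {suc k} (s≤s z≤n) =
    ℕₚ.*-zeroʳ (suc (suc k))
  [1+k]*[1+n]C[1+k]≡[1+n]*nCk (suc m) zero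
    rewrite nC1≡n (suc (suc m)) = trans (ℕₚ.+-identityʳ _) (sym (ℕₚ.*-identityʳ _))
  [1+k]*[1+n]C[1+k]≡[1+n]*nCk (suc m) (suc j) = begin
    (2 + j) * (suc n C (2 + j))
      ≡⟨ cong ((2 + j) *_) (sym (nCk+nC[k+1]≡[n+1]C[k+1] n (suc j))) ⟩
    (2 + j) * (n C (1 + j) + n C (2 + j))
      ≡⟨ ℕₚ.*-distribˡ-+ (2 + j) (n C (1 + j)) (n C (2 + j)) ⟩
    (n C (1 + j) + (1 + j) * (n C (1 + j))) + (2 + j) * (n C (2 + j))
      ≡⟨ cong₂ (λ u v → (n C (1 + j) + u) + v)
               ([1+k]*[1+n]C[1+k]≡[1+n]*nCk m j) ([1+k]*[1+n]C[1+k]≡[1+n]*nCk m (suc j)) ⟩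
    (n C (1 + j) + n * (m C j)) + n * (m C (1 + j))
      ≡⟨ ℕₚ.+-assoc (n C (1 + j)) _ _ ⟩
    n C (1 + j) + (n * (m C j) + n * (m C (1 + j)))
      ≡⟨ cong (n C (1 + j) +_) (sym (ℕₚ.*-distribˡ-+ n (m C j) (m C (1 + j)))) ⟩
    n C (1 + j) + n * (m C j + m C (1 + j))
      ≡⟨ cong (λ u → n C (1 + j) + n * u) (nCk+nC[k+1]≡[n+1]C[k+1] m j) ⟩
    n C (1 + j) + n * (n C (1 + j))
      ∎
    where
    open ≡-Reasoning
    n = suc m

  -- By the absorption identity k·C(p,k) = p·C(p-1,k-1), and p does not divide k.
  prime∣pCk : ∀ {p k} → Prime p → 0 < k → k < p → p ∣ p C k
  prime∣pCk {suc n} {suc k} pp _ k<p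
    with euclidsLemma (suc k) (suc n C suc k) pp
           (divides (n C k) (trans ([1+k]*[1+n]C[1+k]≡[1+n]*nCk n k) (ℕₚ.*-comm (suc n) (n C k))))
  ... | inj₂ p∣pCk = p∣pCk
  ... | inj₁ p∣k = ⊥-elim (ℕₚ.<⇒≱ k<p (∣⇒≤ p∣k))

  m<n∸1⇒1+m<n : ∀ {m n} → m < n ∸ 1 → suc m < n
  m<n∸1⇒1+m<n {n = suc n} m<n = s≤s m<n

  toℕ-pred : ∀ {n} (k : Fin n) → toℕ k ≢ 0 → ∃ λ (j : Fin (n ∸ 1)) → suc (toℕ j) ≡ toℕ k
  toℕ-pred fz k≢0 = ⊥-elim (k≢0 refl)
  toℕ-pred (fs j) _ = j , refl

  indicator : ∀ {a} {A : Set a} → Dec A → ℕ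
  indicator (yes _) = 1
  indicator (no _) = 0

  module _ {a p} {A : Set a} {P : Pred A p} (P? : ∀ j → Dec (P j)) where

    count-tabulate : ∀ {q} (f : Fin q → A) → count P? (tabulate f) ≡ ℕΣ.sum (λ j → indicator (P? (f j)))
    count-tabulate {zero} f = refl
    count-tabulate {suc q} f with P? (f fz)
    ... | yes _ = cong suc (count-tabulate (λ j → f (fs j)))
    ... | no _ = count-tabulate (λ j → f (fs j))

  ∑-indicator-none : ∀ {p q} {P : Pred (Fin q) p} (P? : ∀ j → Dec (P j)) → (∀ j → ¬ P j) →
                     ℕΣ.sum (λ j → indicator (P? j)) ≡ 0
  ∑-indicator-none {q = q} P? ¬P = trans (ℕΣ.sum-cong-≗ zero-at) (ℕΣ.sum-replicate-zero q)
    where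
    zero-at : ∀ j → indicator (P? j) ≡ 0
    zero-at j with P? j
    ... | yes Pj = ⊥-elim (¬P j Pj)
    ... | no _ = refl

  ∑-indicator-unique : ∀ {p q} {P : Pred (Fin q) p} (P? : ∀ j → Dec (P j)) →
                       (∀ {j k} → P j → P k → j ≡ k) → ∀ {z} → P z →
                       ℕΣ.sum (λ j → indicator (P? j)) ≡ 1
  ∑-indicator-unique {q = suc q} {P} P? unique {z} Pz = begin
    ℕΣ.sum (λ j → indicator (P? j))
      ≡⟨ ℕΣ.sum-remove {i = z} (λ j → indicator (P? j)) ⟩
    indicator (P? z) + ℕΣ.sum (λ j → indicator (P? (Fin.punchIn z j)))
      ≡⟨ cong₂ _+_ (at-z (P? z)) (∑-indicator-none (λ j → P? (Fin.punchIn z j)) off-z) ⟩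
    1 ∎
    where
    open ≡-Reasoning
    at-z : (d : Dec (P z)) → indicator d ≡ 1
    at-z (yes _) = refl
    at-z (no ¬Pz) = ⊥-elim (¬Pz Pz)
    off-z : ∀ j → ¬ P (Fin.punchIn z j)
    off-z j Pj = Fin.punchInᵢ≢i z j (unique Pj Pz)

  -- Double counting: both sides equal the number of pairs (k, j) with h k ≡ j.
  ∑-indicator-image : ∀ {p q m} {P : Pred (Fin q) p} (P? : ∀ j → Dec (P j)) (h : Fin m → Fin q) →
                      Injective _≡_ _≡_ h → (∀ k → P (h k)) → (∀ j → P j → ∃ λ k → h k ≡ j) →
                      ℕΣ.sum (λ j → indicator (P? j)) ≡ m
  ∑-indicator-image {q = q} {m} {P} P? h h-injective P-image image-P = begin
    ℕΣ.sum (λ j → indicator (P? j))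
      ≡⟨ ℕΣ.sum-cong-≗ fibre-size ⟩
    ℕΣ.sum (λ j → ℕΣ.sum (λ k → indicator (h k Fin.≟ j)))
      ≡⟨ ℕΣ.∑-comm (λ j k → indicator (h k Fin.≟ j)) ⟩
    ℕΣ.sum (λ k → ℕΣ.sum (λ j → indicator (h k Fin.≟ j)))
      ≡⟨ ℕΣ.sum-cong-≗ (λ k → ∑-indicator-unique (h k Fin.≟_) (λ e e′ → trans (sym e) e′) refl) ⟩
    ℕΣ.sum {m} (λ _ → 1)
      ≡⟨ ∑1≡ m ⟩
    m ∎
    where
    open ≡-Reasoning
    fibre-size : ∀ j → indicator (P? j) ≡ ℕΣ.sum (λ k → indicator (h k Fin.≟ j))
    fibre-size j with P? j
    ... | yes Pj = sym (∑-indicator-unique (λ k → h k Fin.≟ j)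
                         (λ e e′ → h-injective (trans e (sym e′))) (proj₂ (image-P j Pj)))
    ... | no ¬Pj = sym (∑-indicator-none (λ k → h k Fin.≟ j) (λ k e → ¬Pj (subst P e (P-image k))))
    ∑1≡ : ∀ n → ℕΣ.sum {n} (λ _ → 1) ≡ n
    ∑1≡ zero = refl
    ∑1≡ (suc n) = cong suc (∑1≡ n)

module AdditiveClosure {q} (Q : ℕ → Set q) (Q-0 : Q 0)
  (Q-+ : ∀ {a b} → Q a → Q b → Q (a ℕ.+ b))
  (Q-∸ : ∀ {a b} → Q a → Q (a ℕ.+ b) → Q b) where

  Q-* : ∀ k {a} → Q a → Q (k ℕ.* a)
  Q-* zero Qa = Q-0
  Q-* (suc k) Qa = Q-+ Qa (Q-* k Qa)

  coprime⇒Q-1 : ∀ {m n} → Coprime m n → Q m → Q n → Q 1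
  coprime⇒Q-1 {m} {n} m⊥n Qm Qn with coprime-Bézout m⊥n
  ... | Bézout.+- x y eq = Q-∸ (Q-* y Qn) (≡.subst Q (≡.trans (≡.sym eq) (ℕₚ.+-comm 1 (y ℕ.* n))) (Q-* x Qm))
  ... | Bézout.-+ x y eq = Q-∸ (Q-* x Qm) (≡.subst Q (≡.trans (≡.sym eq) (ℕₚ.+-comm 1 (x ℕ.* m))) (Q-* y Qn))

module FiniteRing {c ℓ} (R : CommutativeRing c ℓ) {q} (e : HasOrder R q) where

  open CommutativeRing R
  open Bijection e public using (to; to⁻) renaming (injective to to-injective)
  open Bijection e using (strictlySurjective)
  open import Algebra.Properties.Ring ring using (+-identityˡ-unique)
  open import Algebra.Properties.Semiring.Mult semiring using (_×_)
  import Algebra.Properties.CommutativeMonoid.Sum +-commutativeMonoid as Σ+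
  open import Relation.Binary.Reasoning.Setoid setoid

  to∘to⁻ : ∀ x → to (to⁻ x) ≈ x
  to∘to⁻ x = proj₂ (strictlySurjective x)

  module _ (g g⁻ : Carrier → Carrier) (g-cong : Congruent _≈_ _≈_ g) (g⁻-cong : Congruent _≈_ _≈_ g⁻)
           (g∘g⁻ : ∀ x → g (g⁻ x) ≈ x) (g⁻∘g : ∀ x → g⁻ (g x) ≈ x) where

    reindex : Permutation q q
    reindex = permutation (λ j → to⁻ (g (to j))) (λ j → to⁻ (g⁻ (to j)))
      (λ j → to-injective (trans (to∘to⁻ _) (trans (g-cong (to∘to⁻ _)) (g∘g⁻ _))))
      (λ j → to-injective (trans (to∘to⁻ _) (trans (g⁻-cong (to∘to⁻ _)) (g⁻∘g _))))

    to-reindex : ∀ j → to (reindex ⟨$⟩ʳ j) ≈ g (to j)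
    to-reindex j = to∘to⁻ _

  -- Translating every element by 1 leaves the sum of all elements unchanged.
  q×1≈0 : q × 1# ≈ 0#
  q×1≈0 = +-identityˡ-unique (q × 1#) (Σ+.sum to) (sym (begin
    Σ+.sum to                         ≈⟨ Σ+.sum-permute to π ⟩
    Σ+.sum (λ j → to (π ⟨$⟩ʳ j))      ≈⟨ Σ+.sum-cong-≋ (to-reindex (1# +_) (- 1# +_) +-congˡ +-congˡ 1+[-1+x]≈x [-1]+[1+x]≈x) ⟩
    Σ+.sum (λ j → 1# + to j)          ≈⟨ Σ+.∑-distrib-+ (λ _ → 1#) to ⟩
    Σ+.sum {q} (λ _ → 1#) + Σ+.sum to ≈⟨ +-congʳ (Σ+.sum-replicate q) ⟩
    q × 1# + Σ+.sum to                ∎))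
    where
    1+[-1+x]≈x : ∀ x → 1# + (- 1# + x) ≈ x
    1+[-1+x]≈x x = trans (sym (+-assoc _ _ _)) (trans (+-congʳ (-‿inverseʳ 1#)) (+-identityˡ x))
    [-1]+[1+x]≈x : ∀ x → - 1# + (1# + x) ≈ x
    [-1]+[1+x]≈x x = trans (sym (+-assoc _ _ _)) (trans (+-congʳ (-‿inverseˡ 1#)) (+-identityˡ x))
    π = reindex (1# +_) (- 1# +_) +-congˡ +-congˡ 1+[-1+x]≈x [-1]+[1+x]≈x

module FieldTheory {c ℓ} (F : CommutativeRing c ℓ) (isField : IsField F) where

  open CommutativeRing F
  open IsField isField
  open import Algebra.Properties.Ring ring
    using (-1*x≈-x; x[y-z]≈xy-xz; [y-z]x≈yx-zx; -‿+-comm; -‿involutive; +-inverseˡ-unique; +-identityʳ-unique; x∙y⁻¹≈ε⇒x≈y; x≈y⇒x∙y⁻¹≈ε)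
  open import Algebra.Properties.Semiring.Exp semiring
  open import Algebra.Properties.CommutativeSemiring.Exp commutativeSemiring using (^-distrib-*)
  open import Algebra.Properties.Semiring.Mult semiring
  import Algebra.Properties.CommutativeMonoid.Sum +-commutativeMonoid as Σ+
  import Algebra.Properties.CommutativeMonoid.Sum *-commutativeMonoid as ∏
  open import Relation.Binary.Reasoning.Setoid setoid

  1≉0 : 1# ≉ 0#
  1≉0 1≈0 = 0≉1 (sym 1≈0)

  module _ {x} (x≉0 : x ≉ 0#) where

    x⁻¹ : Carrier
    x⁻¹ = proj₁ (inverse x x≉0)

    x*x⁻¹≈1 : x * x⁻¹ ≈ 1#
    x*x⁻¹≈1 = proj₂ (inverse x x≉0)

    x⁻¹*[x*y]≈y : ∀ y → x⁻¹ * (x * y) ≈ y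
    x⁻¹*[x*y]≈y y = trans (sym (*-assoc _ _ _)) (trans (*-congʳ (trans (*-comm _ _) x*x⁻¹≈1)) (*-identityˡ y))

    x*[x⁻¹*y]≈y : ∀ y → x * (x⁻¹ * y) ≈ y
    x*[x⁻¹*y]≈y y = trans (sym (*-assoc _ _ _)) (trans (*-congʳ x*x⁻¹≈1) (*-identityˡ y))

    [y*x⁻¹]*x≈y : ∀ y → (y * x⁻¹) * x ≈ y
    [y*x⁻¹]*x≈y y = trans (*-comm _ _) (trans (*-congˡ (*-comm _ _)) (x*[x⁻¹*y]≈y y))

    *-cancelˡ-≉0 : ∀ {y z} → x * y ≈ x * z → y ≈ z
    *-cancelˡ-≉0 {y} {z} xy≈xz = trans (sym (x⁻¹*[x*y]≈y y)) (trans (*-congˡ xy≈xz) (x⁻¹*[x*y]≈y z))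

  *-cancelʳ-≉0 : ∀ {x y z} → x ≉ 0# → y * x ≈ z * x → y ≈ z
  *-cancelʳ-≉0 x≉0 yx≈zx = *-cancelˡ-≉0 x≉0 (trans (*-comm _ _) (trans yx≈zx (*-comm _ _)))

  x≉0∧y≉0⇒xy≉0 : ∀ {x y} → x ≉ 0# → y ≉ 0# → x * y ≉ 0#
  x≉0∧y≉0⇒xy≉0 {x} x≉0 y≉0 xy≈0 = y≉0 (*-cancelˡ-≉0 x≉0 (trans xy≈0 (sym (zeroʳ x))))

  x≉0⇒x^n≉0 : ∀ n {x} → x ≉ 0# → x ^ n ≉ 0#
  x≉0⇒x^n≉0 zero x≉0 = 1≉0
  x≉0⇒x^n≉0 (suc n) x≉0 = x≉0∧y≉0⇒xy≉0 x≉0 (x≉0⇒x^n≉0 n x≉0)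

  0^n≈0 : ∀ n .{{_ : NonZero n}} → 0# ^ n ≈ 0#
  0^n≈0 (suc n) = zeroˡ _

  1^n≈1 : ∀ n → 1# ^ n ≈ 1#
  1^n≈1 zero = refl
  1^n≈1 (suc n) = trans (*-identityˡ _) (1^n≈1 n)

  x*x^[n∸1]≈x^n : ∀ x n .{{_ : NonZero n}} → x * x ^ (n ∸ 1) ≈ x ^ n
  x*x^[n∸1]≈x^n x (suc n) = refl

  n×0≈0 : ∀ n → n × 0# ≈ 0#
  n×0≈0 zero = refl
  n×0≈0 (suc n) = trans (+-identityˡ _) (n×0≈0 n)

  ×1-homo-^ : ∀ m n → (m ℕ.^ n) × 1# ≈ (m × 1#) ^ n
  ×1-homo-^ m zero = +-identityʳ 1#
  ×1-homo-^ m (suc n) = trans (×1-homo-* m (m ℕ.^ n)) (*-congˡ (×1-homo-^ m n))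

  ∏-≉0 : ∀ {m} (t : Fin m → Carrier) → (∀ j → t j ≉ 0#) → ∏.sum t ≉ 0#
  ∏-≉0 {zero} t t≉0 = 1≉0
  ∏-≉0 {suc m} t t≉0 = x≉0∧y≉0⇒xy≉0 (t≉0 fz) (∏-≉0 (λ j → t (fs j)) (λ j → t≉0 (fs j)))

  ∏-agree-off : ∀ {m} (f g : Fin m → Carrier) (z : Fin m) → (∀ j → j ≢ z → f j ≈ g j) →
                ∏.sum f * g z ≈ ∏.sum g * f z
  ∏-agree-off {suc m} f g z f≈g = begin
    ∏.sum f * g z                         ≈⟨ *-congʳ (∏.sum-remove f) ⟩
    (f z * ∏.sum (removeAt f z)) * g z    ≈⟨ *-congʳ (*-congˡ (∏.sum-cong-≋ λ j → f≈g _ (Fin.punchInᵢ≢i z j))) ⟩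
    (f z * ∏.sum (removeAt g z)) * g z    ≈⟨ solve 3 (λ a b c → (a :* b) :* c := (c :* b) :* a) refl (f z) _ (g z) ⟩
    (g z * ∏.sum (removeAt g z)) * f z    ≈⟨ *-congʳ (∏.sum-remove g) ⟨
    ∏.sum g * f z                         ∎
    where
    open import Algebra.Solver.Ring.NaturalCoefficients.Default commutativeSemiring
      using (solve; _:*_; _:=_)

  ^-distrib-+-if-C≈0 : ∀ n .{{_ : NonZero n}} → (∀ k x → 0 < k → k < n → (n C k) × x ≈ 0#) →
                        ∀ x y → (x + y) ^ n ≈ x ^ n + y ^ n
  ^-distrib-+-if-C≈0 n@(suc m) C≈0 x y = begin
    (x + y) ^ n                                       ≈⟨ Binomial.theorem (*-comm x y) n ⟩
    term fz + Σ+.sum (λ j → term (fs j))              ≈⟨ +-congˡ (Σ+.sum-init-last (λ j → term (fs j))) ⟩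
    term fz + (Σ+.sum (λ j → term (fs (Fin.inject₁ j))) + term (fs (Fin.fromℕ m)))
                                                      ≈⟨ +-cong first (+-cong (∑-zero _ middle) last) ⟩
    y ^ n + (0# + x ^ n)                              ≈⟨ trans (+-congˡ (+-identityˡ _)) (+-comm _ _) ⟩
    x ^ n + y ^ n                                     ∎
    where
    module Binomial = Algebra.Properties.Semiring.Binomial semiring x y
    term = Binomial.binomialTerm n
    ∑-zero : ∀ {m} (t : Fin m → Carrier) → (∀ j → t j ≈ 0#) → Σ+.sum t ≈ 0#
    ∑-zero {m} t t≈0 = trans (Σ+.sum-cong-≋ t≈0) (Σ+.sum-replicate-zero m)
    first : term fz ≈ y ^ n
    first = trans (×-homo-1 _) (*-identityˡ _)
    middle : ∀ j → term (fs (Fin.inject₁ j)) ≈ 0#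
    middle j = C≈0 _ _ (s≤s z≤n) (s≤s (≡.subst (_< m) (≡.sym (Fin.toℕ-inject₁ j)) (Fin.toℕ<n j)))
    toℕ-last = Fin.toℕ-fromℕ n
    last : term (fs (Fin.fromℕ m)) ≈ x ^ n
    last = begin
      term (Fin.fromℕ n)
        ≈⟨ ×-cong (≡.trans (≡.cong (n C_) toℕ-last) (nCn≡1 n))
                  (*-cong (^-congʳ x toℕ-last) (^-congʳ y (≡.trans (≡.cong (n ∸_) toℕ-last) (ℕₚ.n∸n≡0 n)))) ⟩
      1 × (x ^ n * 1#)  ≈⟨ ×-homo-1 _ ⟩
      x ^ n * 1#        ≈⟨ *-identityʳ _ ⟩
      x ^ n             ∎

  module Polynomial where

    open import Algebra.Solver.Ring.NaturalCoefficients.Default commutativeSemiring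
      using (solve; _:+_; _:*_; _:=_)

    -- Coefficient vectors, constant term first; a polynomial of degree m has m + 1 coefficients.
    eval : ∀ {m} → Vec Carrier m → Carrier → Carrier
    eval [] x = 0#
    eval (a ∷ as) x = a + x * eval as x

    quotient : ∀ {m} → Carrier → Vec Carrier (suc m) → Vec Carrier m
    quotient c (a ∷ []) = []
    quotient c (a ∷ b ∷ bs) = eval (b ∷ bs) c ∷ quotient c (b ∷ bs)

    eval-quotient : ∀ {m} c (f : Vec Carrier (suc m)) x →
                    eval f x ≈ (x - c) * eval (quotient c f) x + eval f c
    eval-quotient c (a ∷ []) x = begin
      a + x * 0#               ≈⟨ +-congˡ (trans (zeroʳ x) (sym (zeroʳ c))) ⟩
      a + c * 0#               ≈⟨ +-identityˡ _ ⟨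
      0# + (a + c * 0#)        ≈⟨ +-congʳ (zeroʳ _) ⟨
      (x - c) * 0# + (a + c * 0#) ∎
    eval-quotient c (a ∷ b ∷ bs) x = begin
      a + x * eval g x                ≈⟨ +-congˡ (*-cong x≈[x-c]+c (eval-quotient c g x)) ⟩
      a + (d + c) * (d * Q + G)       ≈⟨ solve 5 (λ a c d Q G → a :+ (d :+ c) :* (d :* Q :+ G)
                                                 := d :* (G :+ (d :+ c) :* Q) :+ (a :+ c :* G)) refl a c d Q G ⟩
      d * (G + (d + c) * Q) + (a + c * G) ≈⟨ +-congʳ (*-congˡ (+-congˡ (*-congʳ (sym x≈[x-c]+c)))) ⟩
      d * (G + x * Q) + (a + c * G)   ∎
      where
      g = b ∷ bs
      d = x - c
      Q = eval (quotient c g) x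
      G = eval g c
      x≈[x-c]+c : x ≈ (x - c) + c
      x≈[x-c]+c = sym (trans (+-assoc x (- c) c) (trans (+-congˡ (-‿inverseˡ c)) (+-identityʳ x)))

    last-quotient : ∀ {m} c (f : Vec Carrier (suc (suc m))) → Vec.last (quotient c f) ≈ Vec.last f
    last-quotient c (a ∷ b ∷ []) = trans (+-congˡ (zeroʳ c)) (+-identityʳ b)
    last-quotient c (a ∷ b ∷ b′ ∷ bs) = last-quotient c (b ∷ b′ ∷ bs)

    -- Each root c splits off a factor X - c, which does not vanish at the remaining roots.
    roots-bounded : ∀ m (f : Vec Carrier (suc m)) → Vec.last f ≉ 0# →
                    (r : Fin (suc m) → Carrier) → Injective _≡_ _≈_ r → (∀ j → eval f (r j) ≈ 0#) → ⊥
    roots-bounded zero (a ∷ []) a≉0 r _ roots = a≉0 (trans (sym (trans (+-congˡ (zeroʳ _)) (+-identityʳ a))) (roots fz))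
    roots-bounded (suc m) f lead≉0 r r-injective roots =
      roots-bounded m (quotient r₀ f) (λ lead≈0 → lead≉0 (trans (sym (last-quotient r₀ f)) lead≈0))
        (λ j → r (fs j)) (λ rj≈rk → Fin.suc-injective (r-injective rj≈rk)) quotient-roots
      where
      r₀ = r fz
      quotient-roots : ∀ j → eval (quotient r₀ f) (r (fs j)) ≈ 0#
      quotient-roots j = *-cancelˡ-≉0 (λ x-r₀≈0 → Fin.0≢1+n (r-injective (sym (x∙y⁻¹≈ε⇒x≈y _ _ x-r₀≈0))))
        (begin
          (x - r₀) * eval (quotient r₀ f) x               ≈⟨ +-identityʳ _ ⟨
          (x - r₀) * eval (quotient r₀ f) x + 0#          ≈⟨ +-congˡ (roots fz) ⟨
          (x - r₀) * eval (quotient r₀ f) x + eval f r₀    ≈⟨ eval-quotient r₀ f x ⟨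
          eval f x                                      ≈⟨ roots (fs j) ⟩
          0#                                            ≈⟨ zeroʳ _ ⟨
          (x - r₀) * 0#                                  ∎)
        where x = r (fs j)

    monomial : ∀ k → Vec Carrier (suc k)
    monomial zero = 1# ∷ []
    monomial (suc k) = 0# ∷ monomial k

    eval-monomial : ∀ k x → eval (monomial k) x ≈ x ^ k
    eval-monomial zero x = trans (+-congˡ (zeroʳ x)) (+-identityʳ 1#)
    eval-monomial (suc k) x = trans (+-identityˡ _) (*-congˡ (eval-monomial k x))

    last-monomial : ∀ k → Vec.last (monomial k) ≈ 1#
    last-monomial zero = refl
    last-monomial (suc zero) = refl
    last-monomial (suc (suc k)) = last-monomial (suc k)

    X^n-X : ∀ n .{{_ : NonTrivial n}} → Vec Carrier (suc n)
    X^n-X (suc (suc m)) = 0# ∷ - 1# ∷ monomial m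

    eval-X^n-X : ∀ n .{{_ : NonTrivial n}} x → eval (X^n-X n) x ≈ x ^ n - x
    eval-X^n-X (suc (suc m)) x = begin
      0# + x * (- 1# + x * eval (monomial m) x)  ≈⟨ +-identityˡ _ ⟩
      x * (- 1# + x * eval (monomial m) x)       ≈⟨ distribˡ x (- 1#) _ ⟩
      x * - 1# + x * (x * eval (monomial m) x)   ≈⟨ +-cong (trans (*-comm x (- 1#)) (-1*x≈-x x))
                                                          (*-congˡ (*-congˡ (eval-monomial m x))) ⟩
      - x + x ^ suc (suc m)                      ≈⟨ +-comm _ _ ⟩
      x ^ suc (suc m) - x                        ∎

    last-X^n-X : ∀ n .{{_ : NonTrivial n}} → Vec.last (X^n-X n) ≈ 1#
    last-X^n-X (suc (suc zero)) = refl
    last-X^n-X (suc (suc (suc m))) = last-monomial (suc m)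

  module FiniteField (_≟_ : Decidable _≈_) {q} (e : HasOrder F q) where

    open FiniteRing F e using (to; to⁻; to-injective; to∘to⁻; reindex; to-reindex)

    zeroToOne : Carrier → Carrier
    zeroToOne x with x ≟ 0#
    ... | yes _ = 1#
    ... | no _ = x

    zeroToOne-≉0 : ∀ x → zeroToOne x ≉ 0#
    zeroToOne-≉0 x with x ≟ 0#
    ... | yes _ = 1≉0
    ... | no x≉0 = x≉0

    zeroToOne-0 : ∀ {x} → x ≈ 0# → zeroToOne x ≈ 1#
    zeroToOne-0 {x} x≈0 with x ≟ 0#
    ... | yes _ = refl
    ... | no x≉0 = ⊥-elim (x≉0 x≈0)

    zeroToOne-≉0⇒id : ∀ {x} → x ≉ 0# → zeroToOne x ≈ x
    zeroToOne-≉0⇒id {x} x≉0 with x ≟ 0#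
    ... | yes x≈0 = ⊥-elim (x≉0 x≈0)
    ... | no _ = refl

    zeroToOne-cong : ∀ {x y} → x ≈ y → zeroToOne x ≈ zeroToOne y
    zeroToOne-cong {x} {y} x≈y with x ≟ 0# | y ≟ 0#
    ... | yes _ | yes _ = refl
    ... | no _ | no _ = x≈y
    ... | yes x≈0 | no y≉0 = ⊥-elim (y≉0 (trans (sym x≈y) x≈0))
    ... | no x≉0 | yes y≈0 = ⊥-elim (x≉0 (trans x≈y y≈0))

    unitProduct : Carrier
    unitProduct = ∏.sum (λ j → zeroToOne (to j))

    unitProduct-scale : ∀ {a} → a ≉ 0# → unitProduct ≈ ∏.sum (λ j → zeroToOne (a * to j))
    unitProduct-scale {a} a≉0 = trans (∏.sum-permute _ π) (∏.sum-cong-≋ λ j → zeroToOne-cong (to-reindex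
      (a *_) (x⁻¹ a≉0 *_) *-congˡ *-congˡ (x*[x⁻¹*y]≈y a≉0) (x⁻¹*[x*y]≈y a≉0) j))
      where π = reindex (a *_) (x⁻¹ a≉0 *_) *-congˡ *-congˡ (x*[x⁻¹*y]≈y a≉0) (x⁻¹*[x*y]≈y a≉0)

    -- a * zeroToOne x and zeroToOne (a * x) agree except at x = 0, where they are a and 1; so by
    -- unitProduct-scale, a ^ q * unitProduct ≈ a * unitProduct.
    x^q≈x : ∀ x → x ^ q ≈ x
    x^q≈x a with a ≟ 0#
    ... | yes a≈0 = trans (^-congˡ q a≈0) (trans (0^n≈0 q {{Fin.nonZeroIndex (to⁻ 0#)}}) (sym a≈0))
    ... | no a≉0 = *-cancelʳ-≉0 (∏-≉0 _ (λ j → zeroToOne-≉0 (to j))) (begin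
      a ^ q * unitProduct                   ≈⟨ *-congʳ (∏.sum-replicate q) ⟨
      ∏.sum {q} (λ _ → a) * unitProduct     ≈⟨ ∏.∑-distrib-+ (λ _ → a) (λ j → zeroToOne (to j)) ⟨
      ∏.sum f                               ≈⟨ *-identityʳ _ ⟨
      ∏.sum f * 1#                          ≈⟨ *-congˡ (zeroToOne-0 (trans (*-congˡ (to∘to⁻ 0#)) (zeroʳ a))) ⟨
      ∏.sum f * g z                         ≈⟨ ∏-agree-off f g z f≈g ⟩
      ∏.sum g * f z                         ≈⟨ *-cong (sym (unitProduct-scale a≉0)) (*-congˡ (zeroToOne-0 (to∘to⁻ 0#))) ⟩
      unitProduct * (a * 1#)                ≈⟨ trans (*-congˡ (*-identityʳ a)) (*-comm _ a) ⟩
      a * unitProduct                       ∎)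
      where
      f g : Fin q → Carrier
      f j = a * zeroToOne (to j)
      g j = zeroToOne (a * to j)
      z = to⁻ 0#
      f≈g : ∀ j → j ≢ z → f j ≈ g j
      f≈g j j≢z = trans (*-congˡ (zeroToOne-≉0⇒id to-j≉0)) (sym (zeroToOne-≉0⇒id (x≉0∧y≉0⇒xy≉0 a≉0 to-j≉0)))
        where
        to-j≉0 : to j ≉ 0#
        to-j≉0 to-j≈0 = j≢z (to-injective (trans to-j≈0 (sym (to∘to⁻ 0#))))

  module Characteristic (p : ℕ) (p-prime : Prime p) (p×1≈0 : p × 1# ≈ 0#) where

    instance
      p-nonTrivial : NonTrivial p
      p-nonTrivial = prime⇒nonTrivial p-prime

      p-nonZero : NonZero p
      p-nonZero = ℕ.nonTrivial⇒nonZero p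

    p∣m⇒m×x≈0 : ∀ {m} x → p ∣ m → m × x ≈ 0#
    p∣m⇒m×x≈0 x (divides d ≡.refl) = begin
      (d ℕ.* p) × x     ≈⟨ ×-assocˡ x d p ⟨
      d × (p × x)       ≈⟨ ×-congʳ d (trans (×-congʳ p (sym (*-identityˡ x))) (sym (×-assoc-* p 1# x))) ⟩
      d × ((p × 1#) * x) ≈⟨ ×-congʳ d (trans (*-congʳ p×1≈0) (zeroˡ x)) ⟩
      d × 0#            ≈⟨ n×0≈0 d ⟩
      0#                ∎

    ^p-distrib-+ : ∀ x y → (x + y) ^ p ≈ x ^ p + y ^ p
    ^p-distrib-+ = ^-distrib-+-if-C≈0 p (λ k x 0<k k<p → p∣m⇒m×x≈0 x (prime∣pCk p-prime 0<k k<p))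

    ×1≉0 : ∀ {d} → 0 < d → d < p → d × 1# ≉ 0#
    ×1≉0 0<d d<p d×1≈0 = 1≉0 (trans (sym (+-identityʳ 1#))
      (×1≈0.coprime⇒Q-1 (prime⇒coprime p-prime {{ℕ.>-nonZero 0<d}} d<p) p×1≈0 d×1≈0))
      where
      module ×1≈0 = AdditiveClosure (λ k → k × 1# ≈ 0#) refl
        (λ {a} {b} a×1≈0 b×1≈0 → trans (×-homo-+ 1# a b) (trans (+-cong a×1≈0 b×1≈0) (+-identityʳ 0#)))
        (λ {a} {b} a×1≈0 [a+b]×1≈0 →
           trans (sym (trans (×-homo-+ 1# a b) (trans (+-congʳ a×1≈0) (+-identityˡ _)))) [a+b]×1≈0)

    ×1-distinct : ∀ {j k} → j < k → k < p → j × 1# ≉ k × 1#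
    ×1-distinct {j} {k} j<k k<p j×1≈k×1 =
      ×1≉0 (ℕₚ.m<n⇒0<n∸m j<k) (ℕₚ.≤-<-trans (ℕₚ.m∸n≤m k j) k<p)
        (+-identityʳ-unique (j × 1#) ((k ∸ j) × 1#) (begin
          j × 1# + (k ∸ j) × 1#   ≈⟨ ×-homo-+ 1# j (k ∸ j) ⟨
          (j ℕ.+ (k ∸ j)) × 1#    ≡⟨ ≡.cong (_× 1#) (ℕₚ.m+[n∸m]≡n (ℕₚ.<⇒≤ j<k)) ⟩
          k × 1#                  ≈⟨ j×1≈k×1 ⟨
          j × 1#                  ∎))

    ×1-injective : ∀ {j k} → j < p → k < p → j × 1# ≈ k × 1# → j ≡ k
    ×1-injective {j} {k} j<p k<p j×1≈k×1 with ℕₚ.<-cmp j k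
    ... | tri≈ _ j≡k _ = j≡k
    ... | tri< j<k _ _ = ⊥-elim (×1-distinct j<k k<p j×1≈k×1)
    ... | tri> _ _ k<j = ⊥-elim (×1-distinct k<j j<p (sym j×1≈k×1))

    ×1-^p : ∀ k → (k × 1#) ^ p ≈ k × 1#
    ×1-^p zero = 0^n≈0 p
    ×1-^p (suc k) = trans (^p-distrib-+ 1# (k × 1#)) (+-cong (1^n≈1 p) (×1-^p k))

    -- The p elements k × 1 are roots of X ^ p - X, so a further root would be one too many.
    ^p-fixed⇒×1 : Decidable _≈_ → ∀ {t} → t ^ p ≈ t → ∃ λ (k : Fin p) → t ≈ toℕ k × 1#
    ^p-fixed⇒×1 _≟_ {t} t^p≈t with Fin.any? (λ (k : Fin p) → t ≟ (toℕ k × 1#))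
    ... | yes found = found
    ... | no ¬found = ⊥-elim (roots-bounded p (X^n-X p) leading≉0 r r-injective r-roots)
      where
      open Polynomial
      r : Fin (suc p) → Carrier
      r fz = t
      r (fs k) = toℕ k × 1#
      r-injective : Injective _≡_ _≈_ r
      r-injective {fz} {fz} _ = ≡.refl
      r-injective {fz} {fs k} t≈k = ⊥-elim (¬found (k , t≈k))
      r-injective {fs j} {fz} j≈t = ⊥-elim (¬found (j , sym j≈t))
      r-injective {fs j} {fs k} j≈k =
        ≡.cong fs (Fin.toℕ-injective (×1-injective (Fin.toℕ<n j) (Fin.toℕ<n k) j≈k))
      r-fixed : ∀ j → r j ^ p ≈ r j
      r-fixed fz = t^p≈t
      r-fixed (fs k) = ×1-^p (toℕ k)
      r-roots : ∀ j → eval (X^n-X p) (r j) ≈ 0#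
      r-roots j = trans (eval-X^n-X p (r j)) (x≈y⇒x∙y⁻¹≈ε (r-fixed j))
      leading≉0 : Vec.last (X^n-X p) ≉ 0#
      leading≉0 leading≈0 = 1≉0 (trans (sym (last-X^n-X p)) leading≈0)

    primeUnit : Fin (p ∸ 1) → Carrier
    primeUnit j = suc (toℕ j) × 1#

    primeUnit≉0 : ∀ j → primeUnit j ≉ 0#
    primeUnit≉0 j = ×1≉0 (s≤s z≤n) (m<n∸1⇒1+m<n (Fin.toℕ<n j))

    primeUnit-injective : Injective _≡_ _≈_ primeUnit
    primeUnit-injective {j} {k} j≈k = Fin.toℕ-injective (ℕₚ.suc-injective
      (×1-injective (m<n∸1⇒1+m<n (Fin.toℕ<n j)) (m<n∸1⇒1+m<n (Fin.toℕ<n k)) j≈k))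

    primeUnit-^p : ∀ j → primeUnit j ^ p ≈ primeUnit j
    primeUnit-^p j = ×1-^p (suc (toℕ j))

    ^p-fixed⇒primeUnit : Decidable _≈_ → ∀ {t} → t ≉ 0# → t ^ p ≈ t → ∃ λ j → t ≈ primeUnit j
    ^p-fixed⇒primeUnit _≟_ t≉0 t^p≈t with ^p-fixed⇒×1 _≟_ t^p≈t
    ... | k , t≈k×1 with toℕ-pred k (λ k≡0 → t≉0 (trans t≈k×1 (reflexive (≡.cong (_× 1#) k≡0))))
    ...   | j , 1+j≡k = j , trans t≈k×1 (reflexive (≡.cong (_× 1#) (≡.sym 1+j≡k)))

    Frob : ℕ → Carrier → Carrier
    Frob k x = x ^ (p ℕ.^ k)

    Frob-cong : ∀ k {x y} → x ≈ y → Frob k x ≈ Frob k y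
    Frob-cong k = ^-congˡ (p ℕ.^ k)

    Frob-zero : ∀ x → Frob 0 x ≈ x
    Frob-zero = *-identityʳ

    Frob-suc : ∀ k x → Frob (suc k) x ≈ Frob k x ^ p
    Frob-suc k x = trans (^-congʳ x (ℕₚ.*-comm p (p ℕ.^ k))) (sym (^-assocʳ x (p ℕ.^ k) p))

    Frob-+ : ∀ a b x → Frob (a ℕ.+ b) x ≈ Frob b (Frob a x)
    Frob-+ a b x = trans (^-congʳ x (ℕₚ.^-distribˡ-+-* p a b)) (sym (^-assocʳ x (p ℕ.^ a) (p ℕ.^ b)))

    Frob-homo-+ : ∀ k x y → Frob k (x + y) ≈ Frob k x + Frob k y
    Frob-homo-+ zero x y = trans (Frob-zero _) (sym (+-cong (Frob-zero x) (Frob-zero y)))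
    Frob-homo-+ (suc k) x y = begin
      Frob (suc k) (x + y)             ≈⟨ Frob-suc k (x + y) ⟩
      Frob k (x + y) ^ p               ≈⟨ ^-congˡ p (Frob-homo-+ k x y) ⟩
      (Frob k x + Frob k y) ^ p        ≈⟨ ^p-distrib-+ _ _ ⟩
      Frob k x ^ p + Frob k y ^ p      ≈⟨ +-cong (Frob-suc k x) (Frob-suc k y) ⟨
      Frob (suc k) x + Frob (suc k) y  ∎

    Frob-homo-* : ∀ k x y → Frob k (x * y) ≈ Frob k x * Frob k y
    Frob-homo-* k x y = ^-distrib-* x y (p ℕ.^ k)

    Frob-homo-0# : ∀ k → Frob k 0# ≈ 0#
    Frob-homo-0# k = 0^n≈0 (p ℕ.^ k) {{ℕₚ.m^n≢0 p k}}

    Frob-homo-1# : ∀ k → Frob k 1# ≈ 1#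
    Frob-homo-1# k = 1^n≈1 (p ℕ.^ k)

    Frob-homo-neg : ∀ k x → Frob k (- x) ≈ - Frob k x
    Frob-homo-neg k x = +-inverseˡ-unique (Frob k (- x)) (Frob k x)
      (trans (sym (Frob-homo-+ k (- x) x)) (trans (Frob-cong k (-‿inverseˡ x)) (Frob-homo-0# k)))

    Frob-homo-minus : ∀ k x y → Frob k (x - y) ≈ Frob k x - Frob k y
    Frob-homo-minus k x y = trans (Frob-homo-+ k x (- y)) (+-congˡ (Frob-homo-neg k y))

    Frob-≉0 : ∀ k {x} → x ≉ 0# → Frob k x ≉ 0#
    Frob-≉0 k = x≉0⇒x^n≉0 (p ℕ.^ k)

    ^p-fixed⇒Frob-fixed : ∀ {t} → t ^ p ≈ t → ∀ k → Frob k t ≈ t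
    ^p-fixed⇒Frob-fixed t^p≈t zero = Frob-zero _
    ^p-fixed⇒Frob-fixed {t} t^p≈t (suc k) =
      trans (Frob-suc k t) (trans (^-congˡ p (^p-fixed⇒Frob-fixed t^p≈t k)) t^p≈t)

    ^p-fixed⇒^[p^k∸1]≈1 : ∀ {t} → t ≉ 0# → t ^ p ≈ t → ∀ k → t ^ (p ℕ.^ k ∸ 1) ≈ 1#
    ^p-fixed⇒^[p^k∸1]≈1 {t} t≉0 t^p≈t k = *-cancelˡ-≉0 t≉0 (begin
      t * t ^ (p ℕ.^ k ∸ 1)  ≈⟨ x*x^[n∸1]≈x^n t (p ℕ.^ k) {{ℕₚ.m^n≢0 p k}} ⟩
      Frob k t               ≈⟨ ^p-fixed⇒Frob-fixed t^p≈t k ⟩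
      t                      ≈⟨ *-identityʳ t ⟨
      t * 1#                 ∎)

    x≈-x⇒x≈0 : p ≢ 2 → ∀ {x} → x ≈ - x → x ≈ 0#
    x≈-x⇒x≈0 p≢2 {x} x≈-x = *-cancelˡ-≉0 (×1≉0 (s≤s z≤n) 2<p) (begin
      (2 × 1#) * x   ≈⟨ ×-assoc-* 2 1# x ⟩
      2 × (1# * x)   ≈⟨ ×-congʳ 2 (*-identityˡ x) ⟩
      x + (x + 0#)   ≈⟨ +-congˡ (trans (+-identityʳ x) x≈-x) ⟩
      x + - x        ≈⟨ -‿inverseʳ x ⟩
      0#             ≈⟨ zeroʳ _ ⟨
      (2 × 1#) * 0#  ∎)
      where 2<p = ℕₚ.≤∧≢⇒< (ℕ.nonTrivial⇒n>1 p) (≡.≢-sym p≢2)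

    module FrobeniusPeriods (t : Carrier) = AdditiveClosure (λ k → Frob k t ≈ t) (Frob-zero t)
      (λ {a} {b} Frob-a Frob-b → trans (Frob-+ a b t) (trans (Frob-cong b Frob-a) Frob-b))
      (λ {a} {b} Frob-a Frob-a+b → trans (Frob-cong b (sym Frob-a)) (trans (sym (Frob-+ a b t)) Frob-a+b))

  -1^[1+2k]≈-1 : ∀ k → (- 1#) ^ suc (k ℕ.* 2) ≈ - 1#
  -1^[1+2k]≈-1 zero = *-identityʳ _
  -1^[1+2k]≈-1 (suc k) = begin
    - 1# * (- 1# * (- 1#) ^ suc (k ℕ.* 2))  ≈⟨ *-assoc _ _ _ ⟨
    (- 1# * - 1#) * (- 1#) ^ suc (k ℕ.* 2)  ≈⟨ *-cong (trans (-1*x≈-x (- 1#)) (-‿involutive 1#)) (-1^[1+2k]≈-1 k) ⟩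
    1# * - 1#                               ≈⟨ *-identityˡ _ ⟩
    - 1#                                    ∎

  -1^odd≈-1 : ∀ n → n % 2 ≡ 1 → (- 1#) ^ n ≈ - 1#
  -1^odd≈-1 n n%2≡1 = trans (^-congʳ (- 1#) n≡1+2k) (-1^[1+2k]≈-1 (n / 2))
    where n≡1+2k = ≡.trans (m≡m%n+[m/n]*n n 2) (≡.cong (ℕ._+ (n / 2) ℕ.* 2) n%2≡1)

  module Norm (σ : Carrier → Carrier) (σ-cong : Congruent _≈_ _≈_ σ)
              (σ-homo-* : ∀ x y → σ (x * y) ≈ σ x * σ y) (σ-≉0 : ∀ {x} → x ≉ 0# → σ x ≉ 0#) where

    norm : ℕ → Carrier → Carrier
    norm zero x = 1#
    norm (suc k) x = x * norm k (σ x)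

    norm-cong : ∀ k {x y} → x ≈ y → norm k x ≈ norm k y
    norm-cong zero _ = refl
    norm-cong (suc k) x≈y = *-cong x≈y (norm-cong k (σ-cong x≈y))

    norm-homo-* : ∀ k x y → norm k (x * y) ≈ norm k x * norm k y
    norm-homo-* zero x y = sym (*-identityʳ 1#)
    norm-homo-* (suc k) x y = begin
      (x * y) * norm k (σ (x * y))             ≈⟨ *-congˡ (norm-cong k (σ-homo-* x y)) ⟩
      (x * y) * norm k (σ x * σ y)             ≈⟨ *-congˡ (norm-homo-* k (σ x) (σ y)) ⟩
      (x * y) * (norm k (σ x) * norm k (σ y))  ≈⟨ solve 4 (λ x y u v → (x :* y) :* (u :* v) := (x :* u) :* (y :* v))
                                                         refl x y (norm k (σ x)) (norm k (σ y)) ⟩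
      (x * norm k (σ x)) * (y * norm k (σ y))  ∎
      where
      open import Algebra.Solver.Ring.NaturalCoefficients.Default commutativeSemiring
        using (solve; _:*_; _:=_)

    norm-≉0 : ∀ k {x} → x ≉ 0# → norm k x ≉ 0#
    norm-≉0 zero _ = 1≉0
    norm-≉0 (suc k) x≉0 = x≉0∧y≉0⇒xy≉0 x≉0 (norm-≉0 k (σ-≉0 x≉0))

    norm-suc : ∀ k x → norm (suc k) x ≈ norm k x * iterate σ x k
    norm-suc zero x = *-comm x 1#
    norm-suc (suc k) x = trans (*-congˡ (norm-suc k (σ x))) (sym (*-assoc _ _ _))

    norm-σ : ∀ n {x} → iterate σ x n ≈ x → x ≉ 0# → norm n (σ x) ≈ norm n x
    norm-σ n {x} σⁿx≈x x≉0 = *-cancelˡ-≉0 x≉0 (begin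
      norm (suc n) x           ≈⟨ norm-suc n x ⟩
      norm n x * iterate σ x n ≈⟨ *-congˡ σⁿx≈x ⟩
      norm n x * x             ≈⟨ *-comm _ _ ⟩
      x * norm n x             ∎)

    norm-fixed : ∀ k {x} → σ x ≈ x → norm k x ≈ x ^ k
    norm-fixed zero _ = refl
    norm-fixed (suc k) σx≈x = *-congˡ (trans (norm-cong k σx≈x) (norm-fixed k σx≈x))

  module Fibres (_≟_ : Decidable _≈_) (p n i : ℕ) (p-prime : Prime p) (p≢2 : p ≢ 2) (n-odd : n % 2 ≡ 1)
                (i<n : i < n) (gcd[i,n]≡1 : gcd i n ≡ 1) (e : HasOrder F (p ℕ.^ n)) where

    open FiniteRing F e using (q×1≈0)
    open FiniteField _≟_ e using (x^q≈x)
    open import Algebra.Solver.Ring.NaturalCoefficients.Default commutativeSemiring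
      using (solve; _:+_; _:*_; _:=_)
    open import Algebra.Properties.CommutativeSemigroup +-commutativeSemigroup
      using () renaming (interchange to +-interchange)

    p×1≈0 : p × 1# ≈ 0#
    p×1≈0 with (p × 1#) ≟ 0#
    ... | yes p×1≈0 = p×1≈0
    ... | no p×1≉0 = ⊥-elim (x≉0⇒x^n≉0 n p×1≉0 (trans (sym (×1-homo-^ p n)) q×1≈0))

    open Characteristic p p-prime p×1≈0 public

    σ τ : Carrier → Carrier
    σ = Frob i
    τ = Frob (n ∸ i)

    Φ : Carrier → Carrier
    Φ = φ F p n i

    Φ-cong : ∀ {x y} → x ≈ y → Φ x ≈ Φ y
    Φ-cong x≈y = +-cong (^-congˡ (p ℕ.^ i ∸ 1) x≈y) (-‿cong (^-congˡ (p ℕ.^ (n ∸ i) ∸ 1) x≈y))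

    σ∘τ≈id : ∀ x → σ (τ x) ≈ x
    σ∘τ≈id x = trans (sym (Frob-+ (n ∸ i) i x))
                     (trans (^-congʳ x (≡.cong (p ℕ.^_) (ℕₚ.m∸n+n≡m (ℕₚ.<⇒≤ i<n)))) (x^q≈x x))

    x*Φx≈σx-τx : ∀ x → x * Φ x ≈ σ x - τ x
    x*Φx≈σx-τx x = trans (x[y-z]≈xy-xz x _ _)
      (+-cong (x*x^[n∸1]≈x^n x (p ℕ.^ i) {{ℕₚ.m^n≢0 p i}})
              (-‿cong (x*x^[n∸1]≈x^n x (p ℕ.^ (n ∸ i)) {{ℕₚ.m^n≢0 p (n ∸ i)}})))

    σ-identity : ∀ x → σ x * σ (Φ x) + x ≈ σ (σ x)
    σ-identity x = begin
      σ x * σ (Φ x) + x         ≈⟨ +-congʳ (Frob-homo-* i x (Φ x)) ⟨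
      σ (x * Φ x) + x           ≈⟨ +-congʳ (Frob-cong i (x*Φx≈σx-τx x)) ⟩
      σ (σ x - τ x) + x         ≈⟨ +-congʳ (Frob-homo-minus i (σ x) (τ x)) ⟩
      (σ (σ x) - σ (τ x)) + x   ≈⟨ +-congʳ (+-congˡ (-‿cong (σ∘τ≈id x))) ⟩
      (σ (σ x) - x) + x         ≈⟨ +-assoc _ _ _ ⟩
      σ (σ x) + (- x + x)       ≈⟨ +-congˡ (-‿inverseˡ x) ⟩
      σ (σ x) + 0#              ≈⟨ +-identityʳ _ ⟩
      σ (σ x)                   ∎

    -- Compare σ-identity at a and at t * a, using Φ (t * a) ≈ Φ a to eliminate σ (Φ a).
    Φ-fibre-equation : ∀ a t → Φ (t * a) ≈ Φ a → σ (t - σ t) * σ (σ a) + (t - σ t) * a ≈ 0#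
    Φ-fibre-equation a t Φ[ta]≈Φa = begin
      σ (t - T₁) * A₂ + (t - T₁) * a                  ≈⟨ +-congʳ (*-congʳ (Frob-homo-minus i t T₁)) ⟩
      (T₁ - T₂) * A₂ + (t - T₁) * a                   ≈⟨ +-cong ([y-z]x≈yx-zx A₂ T₁ T₂) ([y-z]x≈yx-zx a t T₁) ⟩
      (T₁ * A₂ - T₂ * A₂) + (t * a - T₁ * a)          ≈⟨ +-interchange _ _ _ _ ⟩
      (T₁ * A₂ + t * a) + (- (T₂ * A₂) + - (T₁ * a))  ≈⟨ +-congˡ (-‿+-comm _ _) ⟩
      (T₁ * A₂ + t * a) - (T₂ * A₂ + T₁ * a)          ≈⟨ x≈y⇒x∙y⁻¹≈ε balance ⟩
      0#                                              ∎
      where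
      T₁ = σ t
      T₂ = σ T₁
      A₁ = σ a
      A₂ = σ A₁
      B = σ (Φ a)
      balance : T₁ * A₂ + t * a ≈ T₂ * A₂ + T₁ * a
      balance = begin
        T₁ * A₂ + t * a                   ≈⟨ +-congʳ (*-congˡ (σ-identity a)) ⟨
        T₁ * (A₁ * B + a) + t * a         ≈⟨ solve 5 (λ T₁ A₁ B a t → T₁ :* (A₁ :* B :+ a) :+ t :* a
                                                     := (T₁ :* A₁ :* B :+ t :* a) :+ T₁ :* a) refl T₁ A₁ B a t ⟩
        (T₁ * A₁ * B + t * a) + T₁ * a    ≈⟨ +-congʳ twisted ⟩
        T₂ * A₂ + T₁ * a                  ∎
        where
        twisted : T₁ * A₁ * B + t * a ≈ T₂ * A₂
        twisted = begin
          T₁ * A₁ * B + t * a               ≈⟨ +-congʳ (*-cong (Frob-homo-* i t a) (Frob-cong i Φ[ta]≈Φa)) ⟨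
          σ (t * a) * σ (Φ (t * a)) + t * a ≈⟨ σ-identity (t * a) ⟩
          σ (σ (t * a))                     ≈⟨ trans (Frob-cong i (Frob-homo-* i t a)) (Frob-homo-* i T₁ A₁) ⟩
          T₂ * A₂                           ∎

    open Norm σ (Frob-cong i) (Frob-homo-* i) (Frob-≉0 i)

    iterate-σ : ∀ k x → iterate σ x k ≈ Frob (k ℕ.* i) x
    iterate-σ zero x = sym (Frob-zero x)
    iterate-σ (suc k) x = trans (iterate-σ k (σ x)) (sym (Frob-+ i (k ℕ.* i) x))

    σ^n≈id : ∀ x → iterate σ x n ≈ x
    σ^n≈id x = trans (iterate-σ n x)
      (trans (^-congʳ x (≡.cong (p ℕ.^_) (ℕₚ.*-comm n i))) (FrobeniusPeriods.Q-* x i (x^q≈x x)))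

    norm[-1]≈-1 : norm n (- 1#) ≈ - 1#
    norm[-1]≈-1 = trans (norm-fixed n (trans (Frob-homo-neg i 1#) (-‿cong (Frob-homo-1# i)))) (-1^odd≈-1 n n-odd)

    -- Taking norms gives N u * N a ≈ - (N u * N a), impossible for u ≉ 0 as p is odd.
    Φ-fibre-equation⇒0 : ∀ {u a} → a ≉ 0# → σ u * σ (σ a) + u * a ≈ 0# → u ≈ 0#
    Φ-fibre-equation⇒0 {u} {a} a≉0 equation with u ≟ 0#
    ... | yes u≈0 = u≈0
    ... | no u≉0 = ⊥-elim (x≉0∧y≉0⇒xy≉0 (norm-≉0 n u≉0) (norm-≉0 n a≉0) (x≈-x⇒x≈0 p≢2 (begin
      norm n u * norm n a               ≈⟨ *-cong (norm-σ n (σ^n≈id u) u≉0)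
                                                  (trans (norm-σ n (σ^n≈id A₁) (Frob-≉0 i a≉0)) (norm-σ n (σ^n≈id a) a≉0)) ⟨
      norm n (σ u) * norm n (σ A₁)      ≈⟨ norm-homo-* n (σ u) (σ A₁) ⟨
      norm n (σ u * σ A₁)               ≈⟨ norm-cong n (+-inverseˡ-unique _ _ equation) ⟩
      norm n (- (u * a))                ≈⟨ norm-cong n (-1*x≈-x _) ⟨
      norm n (- 1# * (u * a))           ≈⟨ norm-homo-* n (- 1#) (u * a) ⟩
      norm n (- 1#) * norm n (u * a)    ≈⟨ *-cong norm[-1]≈-1 (norm-homo-* n u a) ⟩
      - 1# * (norm n u * norm n a)      ≈⟨ -1*x≈-x _ ⟩
      - (norm n u * norm n a)           ∎)))
      where A₁ = σ a

    σ-fixed⇒^p-fixed : ∀ {t} → σ t ≈ t → t ^ p ≈ t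
    σ-fixed⇒^p-fixed {t} σt≈t = trans (^-congʳ t (≡.sym (ℕₚ.*-identityʳ p)))
      (FrobeniusPeriods.coprime⇒Q-1 t {i} {n} (gcd≡1⇒coprime gcd[i,n]≡1) σt≈t (x^q≈x t))

    Φ-fibre⇒primeUnit : ∀ {a b} → a ≉ 0# → b ≉ 0# → Φ b ≈ Φ a → ∃ λ j → b ≈ primeUnit j * a
    Φ-fibre⇒primeUnit {a} {b} a≉0 b≉0 Φb≈Φa =
      Product.map₂ (λ t≈j → trans b≈ta (*-congʳ t≈j)) (^p-fixed⇒primeUnit _≟_ t≉0 (σ-fixed⇒^p-fixed (sym t≈σt)))
      where
      t = b * x⁻¹ a≉0
      b≈ta : b ≈ t * a
      b≈ta = sym ([y*x⁻¹]*x≈y a≉0 b)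
      t≉0 : t ≉ 0#
      t≉0 t≈0 = b≉0 (trans b≈ta (trans (*-congʳ t≈0) (zeroˡ a)))
      t≈σt : t ≈ σ t
      t≈σt = x∙y⁻¹≈ε⇒x≈y _ _ (Φ-fibre-equation⇒0 a≉0 (Φ-fibre-equation a t (trans (Φ-cong (sym b≈ta)) Φb≈Φa)))

    Φ-primeUnit : ∀ j a → Φ (primeUnit j * a) ≈ Φ a
    Φ-primeUnit j a = +-cong (cancel i) (-‿cong (cancel (n ∸ i)))
      where
      cancel : ∀ k → (primeUnit j * a) ^ (p ℕ.^ k ∸ 1) ≈ a ^ (p ℕ.^ k ∸ 1)
      cancel k = trans (^-distrib-* (primeUnit j) a (p ℕ.^ k ∸ 1))
        (trans (*-congʳ (^p-fixed⇒^[p^k∸1]≈1 (primeUnit≉0 j) (primeUnit-^p j) k)) (*-identityˡ _))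

open import Data.Nat using (_^_)

lemma3p6 : ∀ {c ℓ} (F : CommutativeRing c ℓ) → IsField F →
           (p n i : ℕ) → Prime p → p ≢ 2 → n % 2 ≡ 1 →
           0 < i → i < n → gcd i n ≡ 1 →
           (e : HasOrder F (p ^ n)) →
           (_≟_ : Decidable (CommutativeRing._≈_ F)) →
           ∀ a → ¬ (CommutativeRing._≈_ F a (CommutativeRing.0# F)) →
           preimageCount F _≟_ (p ^ n) e (φ F p n i) (φ F p n i a) ≡ p ∸ 1
lemma3p6 F isField p n i p-prime p≢2 n-odd _ i<n gcd[i,n]≡1 e _≟_ a a≉0 =
  ≡.trans (count-tabulate P? to) (∑-indicator-image (λ k → P? (to k)) h h-injective h-in-fibre fibre-in-h)
  where
  open CommutativeRing F
  open FieldTheory F isField using (x≉0∧y≉0⇒xy≉0; *-cancelʳ-≉0; module Fibres)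
  open Fibres _≟_ p n i p-prime p≢2 n-odd i<n gcd[i,n]≡1 e
  open FiniteRing F e using (to; to⁻; to∘to⁻; to-injective)

  P? : ∀ x → Dec ((x ≉ 0#) Product.× (Φ x ≈ Φ a))
  P? x = ¬? (x ≟ 0#) ×-dec (Φ x ≟ Φ a)
  h : Fin (p ∸ 1) → Fin (p ^ n)
  h j = to⁻ (primeUnit j * a)
  to-h : ∀ j → to (h j) ≈ primeUnit j * a
  to-h j = to∘to⁻ _
  h-injective : Injective _≡_ _≡_ h
  h-injective {j} {k} hj≡hk = primeUnit-injective (*-cancelʳ-≉0 a≉0
    (trans (sym (to-h j)) (trans (reflexive (≡.cong to hj≡hk)) (to-h k))))
  h-in-fibre : ∀ j → (to (h j) ≉ 0#) Product.× (Φ (to (h j)) ≈ Φ a)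
  h-in-fibre j = (λ to-hj≈0 → x≉0∧y≉0⇒xy≉0 (primeUnit≉0 j) a≉0 (trans (sym (to-h j)) to-hj≈0))
               , trans (Φ-cong (to-h j)) (Φ-primeUnit j a)
  fibre-in-h : ∀ k → (to k ≉ 0#) Product.× (Φ (to k) ≈ Φ a) → ∃ λ j → h j ≡ k
  fibre-in-h k (to-k≉0 , Φ[to-k]≈Φa) = Product.map₂ (λ {j} to-k≈ja → to-injective (trans (to-h j) (sym to-k≈ja)))
                                                    (Φ-fibre⇒primeUnit a≉0 to-k≉0 Φ[to-k]≈Φa)
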